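{- Let $G$ be a finite simple graph and let $e,e'$ be edges of $G$. Then $\Theta_e\circ\Theta_{e'}=\Theta_{e'}\circ\Theta_e$ as maps from tubings of $G$ to tubings of $G-e-e'$.
   Context: For a finite simple graph $G$ with node set $V$: a tube is a nonempty set of nodes inducing a connected subgraph; $V$ is the universal tube (even if $G$ is disconnected). Tubes are compatible if nested or far apart (their union does not induce a connected subgraph). A tubing is a set of pairwise compatible tubes containing $V$; if $G$ is disconnected with components $G_1,\dots,G_k$, a tubing may not contain all of the node sets of $G_1,\dots,G_k$. For an edge $e$ of a graph $H$, $H-e$ deletes $e$ keeping all nodes. For a tube $t$ of $H$ define $\Theta_e(t)=\{t\}$ if $t$ is a tube of $H-e$ (the universal tube counts as a tube of $H-e$), and otherwise $\Theta_e(t)=\{t',t''\}$, the two connected components in $H-e$ of the subgraph induced by $t$. For a tubing $T$ of $H$, $\Theta_e(T)=\bigcup_{t\in T}\Theta_e(t)$, a tubing of $H-e$. -}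

module Defs where

open import Data.Nat using (ℕ)
open import Data.Bool using (Bool; true; false; _∧_; _∨_; not)
open import Data.Fin using (Fin; _≟_)
open import Data.Fin.Subset using (Subset; _∈_; _⊆_; _∪_; ⊤; Nonempty)
open import Data.Product using (Σ; ∃; _×_; _,_)
open import Data.Sum using (_⊎_)
open import Relation.Nullary using (¬_)
open import Relation.Nullary.Decidable using (⌊_⌋)
open import Relation.Binary.PropositionalEquality using (_≡_)
open import Function.Bundles using (_⇔_)

Adj : ℕ → Set
Adj n = Fin n → Fin n → Bool

record SimpleGraph {n : ℕ} (G : Adj n) : Set where
  field
    symmetric   : ∀ x y → G x y ≡ G y x
    irreflexive : ∀ x → G x x ≡ false

IsEdge : ∀ {n} → Adj n → Fin n → Fin n → Set
IsEdge G u v = G u v ≡ true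

deleteEdge : ∀ {n} → Adj n → Fin n → Fin n → Adj n
deleteEdge G u v x y =
  G x y ∧ not ((⌊ x ≟ u ⌋ ∧ ⌊ y ≟ v ⌋) ∨ (⌊ x ≟ v ⌋ ∧ ⌊ y ≟ u ⌋))

data Reach {n} (G : Adj n) (s : Subset n) : Fin n → Fin n → Set where
  here : ∀ {x} → x ∈ s → Reach G s x x
  step : ∀ {x y z} → x ∈ s → G x y ≡ true → Reach G s y z → Reach G s x z

Connected : ∀ {n} → Adj n → Subset n → Set
Connected G s = ∀ x y → x ∈ s → y ∈ s → Reach G s x y

-- A tube: nonempty node set inducing a connected subgraph,
-- or the universal tube V (even if G is disconnected).
IsTube : ∀ {n} → Adj n → Subset n → Set
IsTube G t = (t ≡ ⊤) ⊎ (Nonempty t × Connected G t)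

IsComponentOf : ∀ {n} → Adj n → Subset n → Subset n → Set
IsComponentOf G t c =
  Nonempty c × c ⊆ t × Connected G c
  × (∀ x y → x ∈ c → y ∈ t → G x y ≡ true → y ∈ c)

Compatible : ∀ {n} → Adj n → Subset n → Subset n → Set
Compatible G t₁ t₂ = t₁ ⊆ t₂ ⊎ t₂ ⊆ t₁ ⊎ ¬ Connected G (t₁ ∪ t₂)

SetOfTubes : ℕ → Set₁
SetOfTubes n = Subset n → Set

record IsTubing {n} (G : Adj n) (T : SetOfTubes n) : Set where
  field
    tubes      : ∀ t → T t → IsTube G t
    universal  : T ⊤
    compatible : ∀ t₁ t₂ → T t₁ → T t₂ → Compatible G t₁ t₂
    notAllComponents : ¬ Connected G ⊤ → ¬ (∀ c → IsComponentOf G ⊤ c → T c)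

-- Θ_e(t) for e = {u , v} an edge of H, as a relation: ΘTube H u v t s  iff  s ∈ Θ_e(t).
ΘTube : ∀ {n} → Adj n → Fin n → Fin n → Subset n → Subset n → Set
ΘTube H u v t s =
  (IsTube (deleteEdge H u v) t × s ≡ t)
  ⊎ (¬ IsTube (deleteEdge H u v) t × IsComponentOf (deleteEdge H u v) t s)

Θ : ∀ {n} → Adj n → Fin n → Fin n → SetOfTubes n → SetOfTubes n
Θ H u v T s = ∃ λ t → T t × ΘTube H u v t s

module Submission where

-- Call s a piece of t in a graph K when either t = s = V, or t ≠ V and s is a
-- connected component in K of the subgraph induced by t.  Then
--   (1) s ∈ Θ_e(t)  iff  s is a piece of t in H - e, and
--   (2) for a symmetric graph K and a subgraph K₁ of K, the pieces in K₁ of the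
--       pieces in K of t are exactly the pieces of t in K₁.
-- Consequently Θ_e′(Θ_e(T)) consists of the pieces in (G - e) - e′ of the
-- tubes of T.  Since (G - e) - e′ and (G - e′) - e have the same edges, both
-- composites give the same set, which is the theorem.

open import Defs
open import Data.Fin using (Fin)
open import Data.Fin.Subset using (Subset)
open import Function.Bundles using (_⇔_)

open import Data.Nat using (ℕ; zero; suc; _<_; s≤s)
open import Data.Nat.Properties using (<-≤-trans; ≤-pred)
open import Data.Bool using (Bool; true; false; _∧_; _∨_; not)
open import Data.Bool.Properties using (∧-comm; ∨-comm) renaming (_≟_ to _≟ᵇ_)
open import Data.Fin using (_≟_)
open import Data.Fin.Properties using (any?; all?)
open import Data.Fin.Subset using (_∈_; _∉_; _⊆_; ⊤; Nonempty; _-_; ⁅_⁆; ∣_∣)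
open import Data.Fin.Subset.Properties
  using (_∈?_; nonempty?; ⊆-antisym; ∈⊤; ⊆⊤; ∣p∣≤n; x∈p⇒∣p-x∣<∣p∣; x∈p∧x≢y⇒x∈p-y; p─q⊆p)
open import Data.Vec using (_∷_; tabulate; there)
open import Data.Vec.Properties using (lookup∘tabulate; []=⇒lookup; lookup⇒[]=; ≡-dec)
open import Data.Product using (∃; _×_; _,_)
open import Data.Sum using (_⊎_; inj₁; inj₂; [_,_]′)
open import Relation.Nullary using (Dec; does; yes; no; contradiction)
open import Relation.Nullary.Decidable using (⌊_⌋; _×-dec_; _⊎-dec_; _→-dec_; dec-true)
open import Relation.Binary.PropositionalEquality using (_≡_; _≢_; refl; sym; trans; cong; cong₂; subst)
open import Function.Bundles using (mk⇔; Equivalence)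
import Function.Properties.Equivalence as ⇔

private
  variable
    n : ℕ
    K K′ K₁ : Adj n
    s t c : Subset n
    x y : Fin n

_⊑_ : Adj n → Adj n → Set
K₁ ⊑ K = ∀ a b → K₁ a b ≡ true → K a b ≡ true

Symmetric : Adj n → Set
Symmetric K = ∀ a b → K a b ≡ K b a

Reach-start : Reach K s x y → x ∈ s
Reach-start (here x∈s) = x∈s
Reach-start (step x∈s _ _) = x∈s

Reach-end : Reach K s x y → y ∈ s
Reach-end (here y∈s) = y∈s
Reach-end (step _ _ r) = Reach-end r

Reach-mono : K₁ ⊑ K → s ⊆ t → Reach K₁ s x y → Reach K t x y
Reach-mono K₁⊑K s⊆t (here x∈s) = here (s⊆t x∈s)
Reach-mono K₁⊑K s⊆t (step x∈s e r) = step (s⊆t x∈s) (K₁⊑K _ _ e) (Reach-mono K₁⊑K s⊆t r)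

Reach-++ : ∀ {z} → Reach K s x y → Reach K s y z → Reach K s x z
Reach-++ (here _) r′ = r′
Reach-++ (step x∈s e r) r′ = step x∈s e (Reach-++ r r′)

Reach-reverse : Symmetric K → Reach K s x y → Reach K s y x
Reach-reverse sym-K (here x∈s) = here x∈s
Reach-reverse sym-K (step {x} {y} x∈s e r) =
  Reach-++ (Reach-reverse sym-K r) (step (Reach-start r) (trans (sym-K y x) e) (here x∈s))

ClosedIn : Adj n → Subset n → Subset n → Set
ClosedIn K t c = ∀ a b → a ∈ c → b ∈ t → K a b ≡ true → b ∈ c

Reach-confine : ClosedIn K t c → Reach K t x y → x ∈ c → Reach K c x y
Reach-confine closed (here _) x∈c = here x∈c
Reach-confine closed (step _ e r) x∈c =
  step x∈c e (Reach-confine closed r (closed _ _ x∈c (Reach-start r) e))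

x∉p-x : ∀ (p : Subset n) x → x ∉ p - x
x∉p-x (_ ∷ p) (Fin.suc x) (there x∈) = x∉p-x p x x∈

lastExit : ∀ {a} x → Reach K s a y → x ≢ y
  → Reach K (s - x) a y ⊎ ∃ λ z → K x z ≡ true × Reach K (s - x) z y
lastExit x (here a∈s) x≢y = inj₁ (here (x∈p∧x≢y⇒x∈p-y a∈s (λ a≡x → x≢y (sym a≡x))))
lastExit x (step {a} {b} a∈s e r) x≢y with lastExit x r x≢y
... | inj₂ exit = inj₂ exit
... | inj₁ r′ with a ≟ x
...   | yes refl = inj₂ (b , e , r′)
...   | no a≢x = inj₁ (step (x∈p∧x≢y⇒x∈p-y a∈s a≢x) e r′)

-- Recursion on a bound for ∣ s ∣: for x ≠ y, y is reachable from x in s iff it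
-- is reachable in s - x from some neighbour of x.
reach?-bounded : (K : Adj n) → ∀ k (s : Subset n) → ∣ s ∣ < k → ∀ x y → Dec (Reach K s x y)
reach?-bounded K zero s () x y
reach?-bounded K (suc k) s ∣s∣<k x y with x ∈? s
... | no x∉s = no (λ r → x∉s (Reach-start r))
... | yes x∈s with x ≟ y
...   | yes refl = yes (here x∈s)
...   | no x≢y with any? (λ z → (z ∈? (s - x)) ×-dec ((K x z ≟ᵇ true) ×-dec
          reach?-bounded K k (s - x) (<-≤-trans (x∈p⇒∣p-x∣<∣p∣ x∈s) (≤-pred ∣s∣<k)) z y))
...     | yes (z , _ , e , r) = yes (step x∈s e (Reach-mono (λ _ _ e → e) (p─q⊆p s ⁅ x ⁆) r))
...     | no no-exit = no (λ r → [ (λ r′ → x∉p-x s x (Reach-start r′))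
                                  , (λ { (z , e , r′) → no-exit (z , Reach-start r′ , e , r′) }) ]′
                                  (lastExit x r x≢y))

-- Decidability of reachability, connectivity and tubehood; tubehood is needed
-- to evaluate Θ_e(t), reachability to form a component as a node set.
reach? : (K : Adj n) (s : Subset n) → ∀ x y → Dec (Reach K s x y)
reach? K s = reach?-bounded K _ s (s≤s (∣p∣≤n s))

connected? : (K : Adj n) (t : Subset n) → Dec (Connected K t)
connected? K t = all? λ x → all? λ y → (x ∈? t) →-dec ((y ∈? t) →-dec reach? K t x y)

universal? : (t : Subset n) → Dec (t ≡ ⊤)
universal? t = ≡-dec _≟ᵇ_ t ⊤

tube? : (K : Adj n) (t : Subset n) → Dec (IsTube K t)
tube? K t = universal? t ⊎-dec (nonempty? t ×-dec connected? K t)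

reachableFrom : Adj n → Subset n → Fin n → Subset n
reachableFrom K t x = tabulate (λ y → does (reach? K t x y))

∈reachableFrom⇔ : y ∈ reachableFrom K t x ⇔ Reach K t x y
∈reachableFrom⇔ {y = y} {K = K} {t = t} {x = x} = mk⇔
  (λ y∈ → does-true (reach? K t x y) (trans (sym (lookup∘tabulate f y)) ([]=⇒lookup y∈)))
  (λ r → lookup⇒[]= y _ (trans (lookup∘tabulate f y) (dec-true (reach? K t x y) r)))
  where
  f : Fin _ → Bool
  f z = does (reach? K t x z)
  does-true : ∀ {A : Set} (a? : Dec A) → does a? ≡ true → A
  does-true (yes a) _ = a

reachableFrom-component : Symmetric K → x ∈ t → IsComponentOf K t (reachableFrom K t x)
reachableFrom-component {K = K} {x = x} {t = t} sym-K x∈t =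
  (x , reach→∈ (here x∈t)) , (λ y∈ → Reach-end (∈→reach y∈)) , connected , closed
  where
  reach→∈ : Reach K t x y → y ∈ reachableFrom K t x
  reach→∈ = Equivalence.from ∈reachableFrom⇔
  ∈→reach : y ∈ reachableFrom K t x → Reach K t x y
  ∈→reach = Equivalence.to ∈reachableFrom⇔
  closed : ClosedIn K t (reachableFrom K t x)
  closed a b a∈ b∈t e = let r = ∈→reach a∈ in reach→∈ (Reach-++ r (step (Reach-end r) e (here b∈t)))
  connected : Connected K (reachableFrom K t x)
  connected y z y∈ z∈ =
    Reach-confine closed (Reach-++ (Reach-reverse sym-K (∈→reach y∈)) (∈→reach z∈)) y∈

self-component : Nonempty t → Connected K t → IsComponentOf K t t
self-component ne conn = ne , (λ p → p) , conn , (λ _ _ _ b∈t _ → b∈t)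

component-of-connected : Connected K t → IsComponentOf K t s → s ≡ t
component-of-connected conn ((x , x∈s) , s⊆t , _ , closed) =
  ⊆-antisym s⊆t (λ {y} y∈t → Reach-end (Reach-confine closed (conn x y (s⊆t x∈s) y∈t) x∈s))

component-trans : K₁ ⊑ K → IsComponentOf K t c → IsComponentOf K₁ c s → IsComponentOf K₁ t s
component-trans K₁⊑K (_ , c⊆t , _ , c-closed) (ne , s⊆c , conn , s-closed) =
  ne , (λ p → c⊆t (s⊆c p)) , conn ,
  (λ a b a∈s b∈t e → s-closed a b a∈s (c-closed a b (s⊆c a∈s) b∈t (K₁⊑K a b e)) e)

component-refine : Symmetric K → K₁ ⊑ K → IsComponentOf K₁ t s
  → ∃ λ c → IsComponentOf K t c × IsComponentOf K₁ c s
component-refine {K = K} {t = t} sym-K K₁⊑K ((x , x∈s) , s⊆t , conn , closed) =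
  comp , comp-component , (x , x∈s) , s⊆comp , conn ,
  (λ a b a∈s b∈comp e → closed a b a∈s (comp⊆t b∈comp) e)
  where
  comp : Subset _
  comp = reachableFrom K t x
  comp-component : IsComponentOf K t comp
  comp-component = reachableFrom-component sym-K (s⊆t x∈s)
  comp⊆t : comp ⊆ t
  comp⊆t = let (_ , comp⊆t , _) = comp-component in comp⊆t
  s⊆comp : _ ⊆ comp
  s⊆comp {y} y∈s = Equivalence.from ∈reachableFrom⇔ (Reach-mono K₁⊑K s⊆t (conn x y x∈s y∈s))

component-cong : (∀ a b → K a b ≡ K′ a b) → IsComponentOf K t s → IsComponentOf K′ t s
component-cong K≡K′ (ne , s⊆t , conn , closed) =
  ne , s⊆t ,
  (λ x y x∈s y∈s → Reach-mono (λ a b e → trans (sym (K≡K′ a b)) e) (λ p → p) (conn x y x∈s y∈s)) ,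
  (λ a b a∈s b∈t e → closed a b a∈s b∈t (trans (K≡K′ a b) e))

deleteEdge-⊑ : ∀ (H : Adj n) u v → deleteEdge H u v ⊑ H
deleteEdge-⊑ H u v a b e with H a b
... | true = refl
... | false = e

deleteEdge-symmetric : ∀ {H : Adj n} u v → Symmetric H → Symmetric (deleteEdge H u v)
deleteEdge-symmetric u v sym-H x y =
  cong₂ _∧_ (sym-H x y)
    (cong not (trans (∨-comm (⌊ x ≟ u ⌋ ∧ ⌊ y ≟ v ⌋) (⌊ x ≟ v ⌋ ∧ ⌊ y ≟ u ⌋))
      (cong₂ _∨_ (∧-comm ⌊ x ≟ v ⌋ ⌊ y ≟ u ⌋) (∧-comm ⌊ x ≟ u ⌋ ⌊ y ≟ v ⌋))))

deleteEdge-comm : ∀ (G : Adj n) u v u′ v′ x y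
  → deleteEdge (deleteEdge G u′ v′) u v x y ≡ deleteEdge (deleteEdge G u v) u′ v′ x y
deleteEdge-comm G u v u′ v′ x y = ∧-exchange (G x y) _ _
  where
  ∧-exchange : ∀ g a b → (g ∧ a) ∧ b ≡ (g ∧ b) ∧ a
  ∧-exchange true a b = ∧-comm a b
  ∧-exchange false a b = refl

Piece : Adj n → Subset n → Subset n → Set
Piece K t s = (t ≡ ⊤ × s ≡ ⊤) ⊎ (t ≢ ⊤ × IsComponentOf K t s)

Pieces : Adj n → SetOfTubes n → Subset n → Set
Pieces K T s = ∃ λ t → T t × Piece K t s

⊆-non-universal : c ⊆ t → t ≢ ⊤ → c ≢ ⊤
⊆-non-universal {c = c} c⊆t t≢⊤ c≡⊤ =
  t≢⊤ (⊆-antisym ⊆⊤ (λ {x} _ → c⊆t (subst (x ∈_) (sym c≡⊤) ∈⊤)))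

ΘTube⇔Piece : ∀ (H : Adj n) u v → ΘTube H u v t s ⇔ Piece (deleteEdge H u v) t s
ΘTube⇔Piece {t = t} H u v = mk⇔ to from
  where
  to : ΘTube H u v t _ → Piece (deleteEdge H u v) t _
  to (inj₁ (tube , refl)) with universal? t | tube
  ... | yes t≡⊤ | _ = inj₁ (t≡⊤ , t≡⊤)
  ... | no t≢⊤ | inj₁ t≡⊤ = contradiction t≡⊤ t≢⊤
  ... | no t≢⊤ | inj₂ (ne , conn) = inj₂ (t≢⊤ , self-component ne conn)
  to (inj₂ (not-tube , component)) = inj₂ ((λ t≡⊤ → not-tube (inj₁ t≡⊤)) , component)
  from : Piece (deleteEdge H u v) t _ → ΘTube H u v t _
  from (inj₁ (t≡⊤ , s≡⊤)) = inj₁ (inj₁ t≡⊤ , trans s≡⊤ (sym t≡⊤))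
  from (inj₂ (t≢⊤ , component)) with tube? (deleteEdge H u v) t
  ... | yes (inj₁ t≡⊤) = contradiction t≡⊤ t≢⊤
  ... | yes tube@(inj₂ (_ , conn)) = inj₁ (tube , component-of-connected conn component)
  ... | no not-tube = inj₂ (not-tube , component)

Piece-compose : Symmetric K → K₁ ⊑ K → (∃ λ c → Piece K t c × Piece K₁ c s) ⇔ Piece K₁ t s
Piece-compose sym-K K₁⊑K = mk⇔ to from
  where
  to : (∃ λ c → Piece _ _ c × Piece _ c _) → Piece _ _ _
  to (_ , inj₁ (t≡⊤ , _) , inj₁ (_ , s≡⊤)) = inj₁ (t≡⊤ , s≡⊤)
  to (_ , inj₁ (_ , c≡⊤) , inj₂ (c≢⊤ , _)) = contradiction c≡⊤ c≢⊤
  to (_ , inj₂ (t≢⊤ , (_ , c⊆t , _)) , inj₁ (c≡⊤ , _)) = contradiction c≡⊤ (⊆-non-universal c⊆t t≢⊤)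
  to (_ , inj₂ (t≢⊤ , tc) , inj₂ (_ , cs)) = inj₂ (t≢⊤ , component-trans K₁⊑K tc cs)
  from : Piece _ _ _ → ∃ λ c → Piece _ _ c × Piece _ c _
  from (inj₁ (t≡⊤ , s≡⊤)) = ⊤ , inj₁ (t≡⊤ , refl) , inj₁ (refl , s≡⊤)
  from (inj₂ (t≢⊤ , ts)) =
    let (c , tc@(_ , c⊆t , _) , cs) = component-refine sym-K K₁⊑K ts
    in c , inj₂ (t≢⊤ , tc) , inj₂ (⊆-non-universal c⊆t t≢⊤ , cs)

ΘΘ⇔Pieces : ∀ {H : Adj n} → Symmetric H → ∀ u v u′ v′ (T : SetOfTubes n) s
  → Θ (deleteEdge H u v) u′ v′ (Θ H u v T) s ⇔ Pieces (deleteEdge (deleteEdge H u v) u′ v′) T s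
ΘΘ⇔Pieces {H = H} sym-H u v u′ v′ T s = mk⇔
  (λ (c , (t , t∈T , θ) , θ′) →
     t , t∈T , to compose (c , to (ΘTube⇔Piece H u v) θ , to (ΘTube⇔Piece _ u′ v′) θ′))
  (λ (t , t∈T , piece) → let (c , p , p′) = from compose piece in
     c , (t , t∈T , from (ΘTube⇔Piece H u v) p) , from (ΘTube⇔Piece _ u′ v′) p′)
  where
  open Equivalence
  compose : ∀ {t s} → (∃ λ c → Piece (deleteEdge H u v) t c × Piece (deleteEdge (deleteEdge H u v) u′ v′) c s)
                    ⇔ Piece (deleteEdge (deleteEdge H u v) u′ v′) t s
  compose = Piece-compose (deleteEdge-symmetric u v sym-H) (deleteEdge-⊑ (deleteEdge H u v) u′ v′)

Pieces-cong : ∀ (T : SetOfTubes n) → (∀ a b → K a b ≡ K′ a b) → Pieces K T s ⇔ Pieces K′ T s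
Pieces-cong T K≡K′ = mk⇔ (transport K≡K′) (transport (λ a b → sym (K≡K′ a b)))
  where
  transport : (∀ a b → K a b ≡ K′ a b) → Pieces K T _ → Pieces K′ T _
  transport eq (t , t∈T , inj₁ universal) = t , t∈T , inj₁ universal
  transport eq (t , t∈T , inj₂ (t≢⊤ , ts)) = t , t∈T , inj₂ (t≢⊤ , component-cong eq ts)

-- Lemma 3.3: Θ_e ∘ Θ_e′ = Θ_e′ ∘ Θ_e.  Both composites equal the pieces of the
-- tubes of T in G - e - e′.

lemma3p3 : ∀ {n} (G : Adj n) → SimpleGraph G
    → (u v u′ v′ : Fin n) → IsEdge G u v → IsEdge G u′ v′
    → (T : SetOfTubes n) → IsTubing G T
    → ∀ (s : Subset n)
    → Θ (deleteEdge G u′ v′) u v (Θ G u′ v′ T) s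
    ⇔ Θ (deleteEdge G u v) u′ v′ (Θ G u v T) s
lemma3p3 G simple u v u′ v′ _ _ T _ s =
  ⇔.trans (ΘΘ⇔Pieces sym-G u′ v′ u v T s)
    (⇔.trans (Pieces-cong T (deleteEdge-comm G u v u′ v′))
      (⇔.sym (ΘΘ⇔Pieces sym-G u v u′ v′ T s)))
  where
  sym-G = SimpleGraph.symmetric simple
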